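{- Let $G$ be a connected graph and $H$ a graph. Then $G\circ H$ has an independent $[1,2]$-set if and only if at least one of the following holds: (1) $G=K_1$ and $H$ has an independent $[1,2]$-set; (2) $G$ has an efficient dominating set and $\gamma_{i[1,2]}(H)\leq 2$; (3) $G$ has an independent $[1,2]$-set and $\gamma_{i[1,2]}(H)=1$.
   Context: All graphs are finite and simple; $N_X(x)$ is the open neighborhood of $x$ in $X$. The lexicographic product $G\circ H$ has vertex set $V(G)\times V(H)$, and $(g,h)$ is adjacent to $(g',h')$ iff either $\{g,g'\}\in E(G)$, or $g=g'$ and $\{h,h'\}\in E(H)$. An independent $[1,2]$-set of a graph $X$ is an independent set $S$ such that every vertex $x\notin S$ satisfies $1\le |N_X(x)\cap S|\le 2$; $\gamma_{i[1,2]}(X)$ is the minimum cardinality of an independent $[1,2]$-set of $X$ (when one exists). An efficient dominating set of $G$ is a set $S$ such that every $v\notin S$ has exactly one neighbor in $S$ and every $v\in S$ has no neighbor in $S$. -}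

module Defs where

open import Data.Nat using (ℕ; zero; suc; _*_; _≤_)
open import Data.Bool using (Bool; true; false; _∨_; _∧_)
open import Data.Fin using (Fin; remQuot)
open import Data.Fin.Properties using (_≟_)
open import Data.Fin.Subset using (Subset; _∈_; _∉_; _∩_; ∣_∣)
open import Data.Vec using (tabulate)
open import Data.Product using (Σ; _×_; _,_; ∃; ∃-syntax)
open import Relation.Nullary.Decidable using (⌊_⌋)
open import Relation.Binary.PropositionalEquality using (_≡_)

record Graph : Set where
  field
    n   : ℕ
    adj : Fin n → Fin n → Bool
open Graph public

record IsSimple (G : Graph) : Set where
  field
    symm      : ∀ x y → adj G x y ≡ adj G y x
    irrefl    : ∀ x → adj G x x ≡ false
    nonempty  : 1 ≤ n G

N : (G : Graph) → Fin (n G) → Subset (n G)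
N G x = tabulate (adj G x)

degIn : (G : Graph) → Subset (n G) → Fin (n G) → ℕ
degIn G S x = ∣ N G x ∩ S ∣

data Reach (G : Graph) : Fin (n G) → Fin (n G) → Set where
  here : ∀ {x} → Reach G x x
  step : ∀ {x y z} → adj G x y ≡ true → Reach G y z → Reach G x z

Connected : Graph → Set
Connected G = ∀ x y → Reach G x y

IsK1 : Graph → Set
IsK1 G = n G ≡ 1

Independent : (G : Graph) → Subset (n G) → Set
Independent G S = ∀ x y → x ∈ S → y ∈ S → adj G x y ≡ false

IsIndep12 : (G : Graph) → Subset (n G) → Set
IsIndep12 G S = Independent G S × (∀ x → x ∉ S → 1 ≤ degIn G S x × degIn G S x ≤ 2)

HasIndep12 : Graph → Set
HasIndep12 G = ∃[ S ] IsIndep12 G S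

GammaI12Is : Graph → ℕ → Set
GammaI12Is G k = (∃[ S ] (IsIndep12 G S × ∣ S ∣ ≡ k))
               × (∀ S → IsIndep12 G S → k ≤ ∣ S ∣)

IsEfficientDom : (G : Graph) → Subset (n G) → Set
IsEfficientDom G S = (∀ v → v ∉ S → degIn G S v ≡ 1) × (∀ v → v ∈ S → degIn G S v ≡ 0)

HasEfficientDom : Graph → Set
HasEfficientDom G = ∃[ S ] IsEfficientDom G S

lexAdj : (G H : Graph) → Fin (n G * n H) → Fin (n G * n H) → Bool
lexAdj G H z z' with remQuot {n G} (n H) z | remQuot {n G} (n H) z'
... | (g , h) | (g' , h') = adj G g g' ∨ (⌊ g ≟ g' ⌋ ∧ adj H h h')

_∘ₗ_ : Graph → Graph → Graph
G ∘ₗ H = record { n = n G * n H ; adj = lexAdj G H }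

module Submission where

-- A subset S of V(G ∘ H) is handled through its characteristic function p.
-- Its fibre over g ∈ V(G) is S_g = { h | (g , h) ∈ S }, of size σ(g), and the
-- whole argument rests on the degree formula
--     |N(g,h) ∩ S| = Σ_{g' ∈ N_G(g)} σ(g') + |N_H(h) ∩ S_g| .
-- Forward direction: if S is an independent [1,2]-set of G ∘ H, fibres over
-- adjacent vertices are never both occupied, every occupied fibre is an
-- independent [1,2]-set of H, and the vertices over an empty fibre see one or
-- two points of S through G.  For G = K₁ this is condition (1).  Otherwise G
-- is connected with a second vertex, so every occupied fibre is seen from a
-- neighbour and has at most two points; then the occupied vertices D form an
-- independent [1,2]-set of G.  If H has an independent [1,2]-set of size 1 we
-- get (3); if not, every occupied fibre has exactly two points, which forces
-- D to be an efficient dominating set, and we get (2).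
-- Backward direction: in each case D × T, for suitable D ⊆ V(G) and
-- T ⊆ V(H), is an independent [1,2]-set of G ∘ H, again by the degree formula.

open import Defs
open import Data.Nat using (ℕ; zero; suc; _+_; _*_; _≤_; _<_; z≤n; s≤s; _≤?_)
open import Data.Nat.Properties
  using (+-*-semiring; ≤-refl; ≤-trans; ≤-antisym; ≤-reflexive; ≤∧≢⇒<; +-mono-≤; +-assoc;
         +-identityʳ; *-identityˡ; *-identityʳ; *-zeroʳ; *-cancelˡ-≤; m≤m+n; m≤n+m;
         m≤n⇒m<n∨m≡n; n≤0⇒n≡0; module ≤-Reasoning)
  renaming (_≟_ to _≟ℕ_)
open import Algebra.Properties.Semiring.Sum +-*-semiring
  using (sum; sum-syntax; sum-cong-≗; sum-replicate-zero; sum-remove; ∑-distrib-+; *-distribˡ-sum)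
open import Data.Bool using (Bool; true; false; _∨_; _∧_; if_then_else_)
open import Data.Bool.Properties using (∧-zeroʳ; ∧-conicalˡ; ∧-conicalʳ; ∨-conicalˡ; ¬-not; not-¬)
  renaming (_≟_ to _≟𝔹_)
open import Data.Fin using (Fin; zero; suc; combine; remQuot; _↑ˡ_; _↑ʳ_; punchIn; fromℕ<)
open import Data.Fin.Properties using (_≟_; remQuot-combine; combine-remQuot; punchInᵢ≢i; all?)
open import Data.Fin.Subset using (Subset; _∈_; _∉_; _∩_; ∣_∣)
open import Data.Fin.Subset.Properties using (_∈?_; anySubset?)
open import Data.Vec using ([]; _∷_; tabulate; lookup)
open import Data.Vec.Properties using (lookup∘tabulate; tabulate∘lookup; lookup-zipWith; []=⇒lookup; lookup⇒[]=)
open import Data.Product using (_×_; _,_; ∃-syntax; proj₁; proj₂; uncurry)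
open import Data.Sum using (_⊎_; inj₁; inj₂)
open import Function using (_∘_)
open import Function.Bundles using (_⇔_; mk⇔; Equivalence)
open import Relation.Nullary using (¬_; Dec; yes; no; contradiction; ¬?)
open import Relation.Nullary.Decidable using (⌊_⌋; isYes≗does; dec-true; _×-dec_; _→-dec_)
open import Relation.Binary.PropositionalEquality
  using (_≡_; _≢_; refl; sym; trans; cong; cong₂; subst; module ≡-Reasoning)

sum-zero : ∀ {m} (f : Fin m → ℕ) → (∀ i → f i ≡ 0) → sum f ≡ 0
sum-zero {m} f f≗0 = trans (sum-cong-≗ f≗0) (sum-replicate-zero m)

sum-mono-≤ : ∀ {m} {f g : Fin m → ℕ} → (∀ i → f i ≤ g i) → sum f ≤ sum g
sum-mono-≤ {zero}  _   = z≤n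
sum-mono-≤ {suc m} f≤g = +-mono-≤ (f≤g zero) (sum-mono-≤ (f≤g ∘ suc))

term≤sum : ∀ {m} (f : Fin m → ℕ) i → f i ≤ sum f
term≤sum f zero    = m≤m+n (f zero) _
term≤sum f (suc i) = ≤-trans (term≤sum (f ∘ suc) i) (m≤n+m _ (f zero))

positive-term : ∀ {m} (f : Fin m → ℕ) → 1 ≤ sum f → ∃[ i ] 1 ≤ f i
positive-term {zero}  f ()
positive-term {suc m} f pos with f zero in f₀
... | suc _ = zero , subst (1 ≤_) (sym f₀) (s≤s z≤n)
... | zero  with positive-term (f ∘ suc) pos
...   | i , fᵢ = suc i , fᵢ

sum-supported : ∀ {m} (f : Fin m → ℕ) i → (∀ j → j ≢ i → f j ≡ 0) → sum f ≡ f i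
sum-supported {suc m} f i vanish = begin
  sum f                              ≡⟨ sum-remove f ⟩
  f i + sum (f ∘ punchIn i)          ≡⟨ cong (f i +_) (sum-zero _ λ j → vanish _ (punchInᵢ≢i i j)) ⟩
  f i + 0                            ≡⟨ +-identityʳ (f i) ⟩
  f i                                ∎
  where open ≡-Reasoning

sum-++ : ∀ a {b} (f : Fin (a + b) → ℕ) → sum f ≡ ∑[ i < a ] f (i ↑ˡ b) + ∑[ j < b ] f (a ↑ʳ j)
sum-++ zero    f = refl
sum-++ (suc a) f = trans (cong (f zero +_) (sum-++ a (f ∘ suc))) (sym (+-assoc (f zero) _ _))

sum-combine : ∀ m {k} (f : Fin (m * k) → ℕ) → sum f ≡ ∑[ i < m ] ∑[ j < k ] f (combine i j)
sum-combine zero    f = refl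
sum-combine (suc m) {k} f =
  trans (sum-++ k f) (cong (∑[ j < k ] f (combine {suc m} zero j) +_) (sum-combine m {k} (f ∘ (k ↑ʳ_))))

indicator : Bool → ℕ
indicator true  = 1
indicator false = 0

count : ∀ {m} → (Fin m → Bool) → ℕ
count {m} p = ∑[ i < m ] indicator (p i)

count-cong : ∀ {m} {p q : Fin m → Bool} → (∀ i → p i ≡ q i) → count p ≡ count q
count-cong p≗q = sum-cong-≗ (cong indicator ∘ p≗q)

count-none : ∀ {m} (p : Fin m → Bool) → (∀ i → p i ≡ false) → count p ≡ 0
count-none _ none = sum-zero _ (cong indicator ∘ none)

count-pos : ∀ {m} (p : Fin m → Bool) {i} → p i ≡ true → 1 ≤ count p
count-pos p {i} pᵢ = subst (λ b → indicator b ≤ count p) pᵢ (term≤sum _ i)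

count-witness : ∀ {m} (p : Fin m → Bool) → 1 ≤ count p → ∃[ i ] p i ≡ true
count-witness p pos with positive-term _ pos
... | i , pᵢ = i , indicator-pos (p i) pᵢ
  where
  indicator-pos : ∀ b → 1 ≤ indicator b → b ≡ true
  indicator-pos true _ = refl

count-empty : ∀ {m} {p : Fin m → Bool} → count p ≡ 0 → ∀ i → p i ≡ false
count-empty {p = p} zero-count i = ¬-not {y = true} λ pᵢ → contradiction (subst (1 ≤_) zero-count (count-pos p pᵢ)) λ ()

count-∧-≤ : ∀ {m} (q p : Fin m → Bool) → count (λ i → q i ∧ p i) ≤ count p
count-∧-≤ q p = sum-mono-≤ λ i → indicator-∧ (q i) (p i)
  where
  indicator-∧ : ∀ a b → indicator (a ∧ b) ≤ indicator b
  indicator-∧ true  b = ≤-refl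
  indicator-∧ false b = z≤n

OneOrTwo : ℕ → Set
OneOrTwo k = 1 ≤ k × k ≤ 2

deg : (G : Graph) → (Fin (n G) → Bool) → Fin (n G) → ℕ
deg G p x = count (λ y → adj G x y ∧ p y)

Independentᶜ : (G : Graph) → (Fin (n G) → Bool) → Set
Independentᶜ G p = ∀ x y → p x ≡ true → p y ≡ true → adj G x y ≡ false

IsIndep12ᶜ : (G : Graph) → (Fin (n G) → Bool) → Set
IsIndep12ᶜ G p = Independentᶜ G p × (∀ x → p x ≡ false → OneOrTwo (deg G p x))

IsEfficientDomᶜ : (G : Graph) → (Fin (n G) → Bool) → Set
IsEfficientDomᶜ G p = (∀ v → p v ≡ false → deg G p v ≡ 1) × (∀ v → p v ≡ true → deg G p v ≡ 0)

∈-tabulate : ∀ {m} {p : Fin m → Bool} {x} → x ∈ tabulate p → p x ≡ true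
∈-tabulate {p = p} {x} x∈ = trans (sym (lookup∘tabulate p x)) ([]=⇒lookup x∈)

tabulate-∈ : ∀ {m} {p : Fin m → Bool} {x} → p x ≡ true → x ∈ tabulate p
tabulate-∈ {p = p} {x} pₓ = lookup⇒[]= x (tabulate p) (trans (lookup∘tabulate p x) pₓ)

∉-tabulate : ∀ {m} {p : Fin m → Bool} {x} → x ∉ tabulate p → p x ≡ false
∉-tabulate x∉ = ¬-not {y = true} (x∉ ∘ tabulate-∈)

tabulate-∉ : ∀ {m} {p : Fin m → Bool} {x} → p x ≡ false → x ∉ tabulate p
tabulate-∉ pₓ x∈ = not-¬ (∈-tabulate x∈) pₓ

∣∣-lookup : ∀ {m} (S : Subset m) → ∣ S ∣ ≡ count (lookup S)
∣∣-lookup []          = refl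
∣∣-lookup (true ∷ S)  = cong suc (∣∣-lookup S)
∣∣-lookup (false ∷ S) = ∣∣-lookup S

∣tabulate∣ : ∀ {m} (p : Fin m → Bool) → ∣ tabulate p ∣ ≡ count p
∣tabulate∣ p = trans (∣∣-lookup (tabulate p)) (count-cong (lookup∘tabulate p))

degIn-tabulate : ∀ G p x → degIn G (tabulate p) x ≡ deg G p x
degIn-tabulate G p x = trans (∣∣-lookup (N G x ∩ tabulate p)) (count-cong λ y →
  trans (lookup-zipWith _∧_ y (tabulate (adj G x)) (tabulate p))
        (cong₂ _∧_ (lookup∘tabulate (adj G x) y) (lookup∘tabulate p y)))

indep12-tabulate : ∀ G p → IsIndep12 G (tabulate p) ⇔ IsIndep12ᶜ G p
indep12-tabulate G p = mk⇔
  (λ (indep , bounded) →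
     (λ x y pₓ p_y → indep x y (tabulate-∈ pₓ) (tabulate-∈ p_y)) ,
     (λ x pₓ → subst OneOrTwo (degIn-tabulate G p x) (bounded x (tabulate-∉ pₓ))))
  (λ (indep , bounded) →
     (λ x y x∈ y∈ → indep x y (∈-tabulate x∈) (∈-tabulate y∈)) ,
     (λ x x∉ → subst OneOrTwo (sym (degIn-tabulate G p x)) (bounded x (∉-tabulate x∉))))

efficientDom-tabulate : ∀ G p → IsEfficientDom G (tabulate p) ⇔ IsEfficientDomᶜ G p
efficientDom-tabulate G p = mk⇔
  (λ (outside , inside) →
     (λ v pᵥ → trans (sym (degIn-tabulate G p v)) (outside v (tabulate-∉ pᵥ))) ,
     (λ v pᵥ → trans (sym (degIn-tabulate G p v)) (inside v (tabulate-∈ pᵥ))))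
  (λ (outside , inside) →
     (λ v v∉ → trans (degIn-tabulate G p v) (outside v (∉-tabulate v∉))) ,
     (λ v v∈ → trans (degIn-tabulate G p v) (inside v (∈-tabulate v∈))))

indep12-lookup : ∀ G S → IsIndep12 G S → IsIndep12ᶜ G (lookup S)
indep12-lookup G S = Equivalence.to (indep12-tabulate G (lookup S)) ∘ subst (IsIndep12 G) (sym (tabulate∘lookup S))

efficientDom-lookup : ∀ G S → IsEfficientDom G S → IsEfficientDomᶜ G (lookup S)
efficientDom-lookup G S =
  Equivalence.to (efficientDom-tabulate G (lookup S)) ∘ subst (IsEfficientDom G) (sym (tabulate∘lookup S))

deg-independent : ∀ G {p x} → Independentᶜ G p → p x ≡ true → deg G p x ≡ 0
deg-independent G {p} {x} indep pₓ = count-none (λ y → adj G x y ∧ p y) λ y → lemma y (p y) refl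
  where
  lemma : ∀ y b → p y ≡ b → adj G x y ∧ b ≡ false
  lemma y true  p_y rewrite indep x y pₓ p_y = refl
  lemma y false _   = ∧-zeroʳ (adj G x y)

efficient⇒independent : ∀ G {p} → IsEfficientDomᶜ G p → Independentᶜ G p
efficient⇒independent G {p} (_ , inside) x y pₓ p_y with adj G x y in xy
... | false = refl
... | true  = contradiction (subst (1 ≤_) (inside x pₓ) (count-pos (λ z → adj G x z ∧ p z) (cong₂ _∧_ xy p_y))) λ ()

-- In a graph with a vertex x, an independent [1,2]-set is nonempty:
-- either x lies in it or x has a neighbour in it.
indep12-nonempty : ∀ G {p} → Fin (n G) → IsIndep12ᶜ G p → 1 ≤ count p
indep12-nonempty G {p} x (_ , bounded) with p x in pₓ
... | true  = count-pos p pₓ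
... | false = ≤-trans (proj₁ (bounded x pₓ)) (count-∧-≤ (adj G x) p)

indep12-size-pos : ∀ H {S} → 1 ≤ n H → IsIndep12 H S → 1 ≤ ∣ S ∣
indep12-size-pos H {S} nonempty S-indep12 =
  subst (1 ≤_) (sym (∣∣-lookup S)) (indep12-nonempty H (fromℕ< nonempty) (indep12-lookup H S S-indep12))

HasIndep12OfSize : Graph → ℕ → Set
HasIndep12OfSize H k = ∃[ S ] (IsIndep12 H S × ∣ S ∣ ≡ k)

indep12? : ∀ G S → Dec (IsIndep12 G S)
indep12? G S =
  (all? λ x → all? λ y → (x ∈? S) →-dec ((y ∈? S) →-dec (adj G x y ≟𝔹 false))) ×-dec
  (all? λ x → ¬? (x ∈? S) →-dec ((1 ≤? degIn G S x) ×-dec (degIn G S x ≤? 2)))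

singleton-indep12? : ∀ H → Dec (HasIndep12OfSize H 1)
singleton-indep12? H = anySubset? λ S → indep12? H S ×-dec (∣ S ∣ ≟ℕ 1)

-- γ_{i[1,2]}(H) is 1 exactly when H has such a set of size 1, and 2 when
-- it has one of size 2 but none of size 1 (all of them being nonempty).
gamma-one : ∀ H → 1 ≤ n H → HasIndep12OfSize H 1 → GammaI12Is H 1
gamma-one H nonempty T₁ = T₁ , λ S S-indep12 → indep12-size-pos H nonempty S-indep12

gamma-two : ∀ H → 1 ≤ n H → ¬ HasIndep12OfSize H 1 → HasIndep12OfSize H 2 → GammaI12Is H 2
gamma-two H nonempty ¬T₁ T₂ = T₂ , λ S S-indep12 →
  ≤∧≢⇒< (indep12-size-pos H nonempty S-indep12) λ 1≡∣S∣ → ¬T₁ (S , S-indep12 , sym 1≡∣S∣)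

another-vertex : ∀ {m} → 2 ≤ m → (i : Fin m) → ∃[ j ] i ≢ j
another-vertex {suc (suc m)} _        i = punchIn i zero , punchInᵢ≢i i zero ∘ sym
another-vertex {suc zero}    (s≤s ()) _

has-neighbour : ∀ G → Connected G → 2 ≤ n G → ∀ g → ∃[ g' ] adj G g g' ≡ true
has-neighbour G con two g with another-vertex two g
... | g' , g≢g' = first-step (con g g') g≢g'
  where
  first-step : ∀ {g'} → Reach G g g' → g ≢ g' → ∃[ g'' ] adj G g g'' ≡ true
  first-step here       g≢g = contradiction refl g≢g
  first-step (step a _) _   = _ , a

⌊≟⌋-refl : ∀ {m} (i : Fin m) → ⌊ i ≟ i ⌋ ≡ true
⌊≟⌋-refl i = trans (isYes≗does (i ≟ i)) (dec-true (i ≟ i) refl)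

lexAdj-combine : ∀ G H g h g' h' →
  lexAdj G H (combine g h) (combine g' h') ≡ adj G g g' ∨ (⌊ g ≟ g' ⌋ ∧ adj H h h')
lexAdj-combine G H g h g' h' =
  cong₂ lexAdjPairs (remQuot-combine {n G} {n H} g h) (remQuot-combine {n G} {n H} g' h')
  where
  lexAdjPairs : Fin (n G) × Fin (n H) → Fin (n G) × Fin (n H) → Bool
  lexAdjPairs (g , h) (g' , h') = adj G g g' ∨ (⌊ g ≟ g' ⌋ ∧ adj H h h')

every-pair : ∀ {m k} {P : Fin (m * k) → Set} → (∀ g h → P (combine g h)) → ∀ z → P z
every-pair {m} {k} {P} P-pairs z = subst P (combine-remQuot {m} k z) (uncurry P-pairs (remQuot {m} k z))

module Fibres (G H : Graph) (p : Fin (n G * n H) → Bool) where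

  fibre : Fin (n G) → Fin (n H) → Bool
  fibre g h = p (combine g h)

  σ : Fin (n G) → ℕ
  σ g = count (fibre g)

  nbrTerm : Fin (n G) → Fin (n G) → ℕ
  nbrTerm g g' = if adj G g g' then σ g' else 0

  nbrSum : Fin (n G) → ℕ
  nbrSum g = ∑[ g' < n G ] nbrTerm g g'

  count-by-fibres : count p ≡ ∑[ g < n G ] σ g
  count-by-fibres = sum-combine (n G) _

  degree-formula : (∀ x → adj G x x ≡ false) →
                   ∀ g h → deg (G ∘ₗ H) p (combine g h) ≡ nbrSum g + deg H (fibre g) h
  degree-formula irrefl g h = begin
    deg (G ∘ₗ H) p (combine g h)                  ≡⟨ sum-combine (n G) _ ⟩
    ∑[ g' < n G ] fibreTerm g'                    ≡⟨ sum-cong-≗ fibreTerm-split ⟩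
    ∑[ g' < n G ] (nbrTerm g g' + selfTerm g')    ≡⟨ ∑-distrib-+ (nbrTerm g) selfTerm ⟩
    nbrSum g + ∑[ g' < n G ] selfTerm g'          ≡⟨ cong (nbrSum g +_) (sum-supported selfTerm g selfTerm-off) ⟩
    nbrSum g + selfTerm g                         ≡⟨ cong (λ b → nbrSum g + (if b then deg H (fibre g) h else 0)) (⌊≟⌋-refl g) ⟩
    nbrSum g + deg H (fibre g) h                  ∎
    where
    open ≡-Reasoning
    -- The neighbours of (g , h) in S lying over g'; they come from adjacency
    -- in G (nbrTerm) or, when g' = g, from adjacency in H (selfTerm).
    fibreTerm : Fin (n G) → ℕ
    fibreTerm g' = count (λ h' → lexAdj G H (combine g h) (combine g' h') ∧ fibre g' h')
    selfTerm : Fin (n G) → ℕ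
    selfTerm g' = if ⌊ g ≟ g' ⌋ then deg H (fibre g) h else 0
    selfTerm-off : ∀ g' → g' ≢ g → selfTerm g' ≡ 0
    selfTerm-off g' g'≢g with g ≟ g'
    ... | yes g≡g' = contradiction (sym g≡g') g'≢g
    ... | no _     = refl
    split : ∀ {g'} (g≟g' : Dec (g ≡ g')) →
            count (λ h' → (adj G g g' ∨ (⌊ g≟g' ⌋ ∧ adj H h h')) ∧ fibre g' h') ≡
            nbrTerm g g' + (if ⌊ g≟g' ⌋ then deg H (fibre g) h else 0)
    split (yes refl) rewrite irrefl g = refl
    split {g'} (no _) with adj G g g'
    ... | true  = sym (+-identityʳ (σ g'))
    ... | false = count-none {n H} (λ _ → false) λ _ → refl
    fibreTerm-split : ∀ g' → fibreTerm g' ≡ nbrTerm g g' + selfTerm g'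
    fibreTerm-split g' = trans (count-cong λ h' → cong (_∧ fibre g' h') (lexAdj-combine G H g h g' h'))
                               (split (g ≟ g'))

positive : ℕ → Bool
positive zero    = false
positive (suc _) = true

positive-true : ∀ {k} → positive k ≡ true → 1 ≤ k
positive-true {suc _} _ = s≤s z≤n

positive-false : ∀ {k} → positive k ≡ false → k ≡ 0
positive-false {zero} _ = refl

positive-bounds : ∀ k → (1 ≤ k → k ≤ 2) → indicator (positive k) ≤ k × k ≤ 2 * indicator (positive k)
positive-bounds zero    _   = z≤n , z≤n
positive-bounds (suc k) ≤two = s≤s z≤n , ≤two (s≤s z≤n)

positive-exact : ∀ k → (1 ≤ k → k ≡ 2) → k ≡ 2 * indicator (positive k)
positive-exact zero    _    = refl
positive-exact (suc k) ≡two = ≡two (s≤s z≤n)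

half-pos : ∀ d → 1 ≤ 2 * d → 1 ≤ d
half-pos (suc d) _ = s≤s z≤n

module Analysis (G H : Graph) (sG : IsSimple G) (sH : IsSimple H)
                (p : Fin (n G * n H) → Bool) (S-indep12 : IsIndep12ᶜ (G ∘ₗ H) p) where

  open Fibres G H p public

  private
    irrefl : ∀ x → adj G x x ≡ false
    irrefl = IsSimple.irrefl sG
    independent : Independentᶜ (G ∘ₗ H) p
    independent = proj₁ S-indep12
    bounded : ∀ z → p z ≡ false → OneOrTwo (deg (G ∘ₗ H) p z)
    bounded = proj₂ S-indep12
    g₀ : Fin (n G)
    g₀ = fromℕ< (IsSimple.nonempty sG)
    h₀ : Fin (n H)
    h₀ = fromℕ< (IsSimple.nonempty sH)

  fibres-apart : ∀ {g g' h h'} → fibre g h ≡ true → fibre g' h' ≡ true → adj G g g' ≡ false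
  fibres-apart {g} {g'} {h} {h'} in₁ in₂ =
    ∨-conicalˡ _ _ (trans (sym (lexAdj-combine G H g h g' h')) (independent _ _ in₁ in₂))

  fibre-independent : ∀ g → Independentᶜ H (fibre g)
  fibre-independent g h h' in₁ in₂ = begin
    adj H h h'                             ≡⟨ cong₂ (λ a b → a ∨ (b ∧ adj H h h')) (irrefl g) (⌊≟⌋-refl g) ⟨
    adj G g g ∨ (⌊ g ≟ g ⌋ ∧ adj H h h')   ≡⟨ lexAdj-combine G H g h g h' ⟨
    lexAdj G H (combine g h) (combine g h') ≡⟨ independent _ _ in₁ in₂ ⟩
    false                                  ∎
    where open ≡-Reasoning

  neighbour-empty : ∀ {g g'} → 1 ≤ σ g → adj G g g' ≡ true → σ g' ≡ 0
  neighbour-empty {g} {g'} occupied gg' with count-witness (fibre g) occupied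
  ... | h , in₁ = count-none (fibre g') λ h' →
    ¬-not {y = true} λ in₂ → not-¬ gg' (fibres-apart in₁ in₂)

  nbrSum-occupied : ∀ {g} → 1 ≤ σ g → nbrSum g ≡ 0
  nbrSum-occupied {g} occupied = sum-zero (nbrTerm g) term-zero
    where
    term-zero : ∀ g' → nbrTerm g g' ≡ 0
    term-zero g' with adj G g g' in gg'
    ... | true  = neighbour-empty occupied gg'
    ... | false = refl

  -- An occupied fibre is an independent [1,2]-set of H: its points are seen
  -- only from inside the fibre.
  occupied-fibre-indep12 : ∀ {g} → 1 ≤ σ g → IsIndep12ᶜ H (fibre g)
  occupied-fibre-indep12 {g} occupied = fibre-independent g , λ h out →
    subst OneOrTwo (trans (degree-formula irrefl g h) (cong (_+ deg H (fibre g) h) (nbrSum-occupied occupied)))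
          (bounded (combine g h) out)

  empty-fibre-nbrSum : ∀ {g} → σ g ≡ 0 → OneOrTwo (nbrSum g)
  empty-fibre-nbrSum {g} empty =
    subst OneOrTwo (trans (degree-formula irrefl g h₀) (trans (cong (nbrSum g +_) no-inner) (+-identityʳ _)))
          (bounded (combine g h₀) (count-empty empty h₀))
    where
    no-inner : deg H (fibre g) h₀ ≡ 0
    no-inner = n≤0⇒n≡0 (≤-trans (count-∧-≤ (adj H h₀) (fibre g)) (≤-reflexive empty))

  -- S is nonempty, so some fibre is occupied.
  occupied-exists : ∃[ g ] 1 ≤ σ g
  occupied-exists =
    positive-term σ (subst (1 ≤_) count-by-fibres (indep12-nonempty (G ∘ₗ H) (combine g₀ h₀) S-indep12))

  occupied-fibre-set : ∀ {g} → 1 ≤ σ g → IsIndep12 H (tabulate (fibre g))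
  occupied-fibre-set {g} occupied = Equivalence.from (indep12-tabulate H (fibre g)) (occupied-fibre-indep12 occupied)

  fibre-set : HasIndep12 H
  fibre-set = tabulate (fibre (proj₁ occupied-exists)) , occupied-fibre-set (proj₂ occupied-exists)

  module Connected (two : 2 ≤ n G) (con : Connected G) where

    -- An occupied fibre is seen from a neighbour of g, whose fibre is empty,
    -- hence has at most two points.
    fibre-≤2 : ∀ {g} → 1 ≤ σ g → σ g ≤ 2
    fibre-≤2 {g} occupied with has-neighbour G con two g
    ... | y , gy = begin
      σ g           ≡⟨ cong (λ b → if b then σ g else 0) (trans (IsSimple.symm sG y g) gy) ⟨
      nbrTerm y g   ≤⟨ term≤sum (nbrTerm y) g ⟩
      nbrSum y      ≤⟨ proj₂ (empty-fibre-nbrSum (neighbour-empty occupied gy)) ⟩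
      2             ∎
      where open ≤-Reasoning

    support : Fin (n G) → Bool
    support g = positive (σ g)

    support-independent : Independentᶜ G support
    support-independent g g' in₁ in₂ with adj G g g' in gg'
    ... | false = refl
    ... | true  = contradiction (subst (1 ≤_) (neighbour-empty (positive-true in₁) gg') (positive-true in₂)) λ ()

    nbrTerm-bounds : ∀ g g' → indicator (adj G g g' ∧ support g') ≤ nbrTerm g g'
                            × nbrTerm g g' ≤ 2 * indicator (adj G g g' ∧ support g')
    nbrTerm-bounds g g' with adj G g g'
    ... | true  = positive-bounds (σ g') fibre-≤2
    ... | false = z≤n , z≤n

    nbrSum-≤-2deg : ∀ g → nbrSum g ≤ 2 * deg G support g
    nbrSum-≤-2deg g = ≤-trans (sum-mono-≤ (proj₂ ∘ nbrTerm-bounds g)) (≤-reflexive (sym (*-distribˡ-sum 2 (λ g' → indicator (adj G g g' ∧ support g')))))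

    -- The support is an independent [1,2]-set of G: for g outside it,
    -- |N(g) ∩ support| ≤ nbrSum g ≤ 2 and 1 ≤ nbrSum g ≤ 2 |N(g) ∩ support|.
    support-indep12 : IsIndep12ᶜ G support
    support-indep12 = support-independent , λ g out →
      let bounds = empty-fibre-nbrSum (positive-false out) in
      half-pos _ (≤-trans (proj₁ bounds) (nbrSum-≤-2deg g)) ,
      ≤-trans (sum-mono-≤ (proj₁ ∘ nbrTerm-bounds g)) (proj₂ bounds)

    support-set : HasIndep12 G
    support-set = tabulate support , Equivalence.from (indep12-tabulate G support) support-indep12

    fibre-two : ¬ HasIndep12OfSize H 1 → ∀ {g} → 1 ≤ σ g → σ g ≡ 2
    fibre-two ¬T₁ {g} occupied = ≤-antisym (fibre-≤2 occupied) (≤∧≢⇒< occupied λ 1≡σ →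
      ¬T₁ (tabulate (fibre g) , occupied-fibre-set occupied , trans (∣tabulate∣ (fibre g)) (sym 1≡σ)))

    fibre-pair : ¬ HasIndep12OfSize H 1 → HasIndep12OfSize H 2
    fibre-pair ¬T₁ with occupied-exists
    ... | g₁ , occupied₁ =
      tabulate (fibre g₁) , occupied-fibre-set occupied₁ , trans (∣tabulate∣ (fibre g₁)) (fibre-two ¬T₁ occupied₁)

    -- With all occupied fibres of size 2, nbrSum g = 2 |N(g) ∩ support|, and
    -- 1 ≤ nbrSum g ≤ 2 forces |N(g) ∩ support| = 1.
    support-efficient : ¬ HasIndep12OfSize H 1 → IsEfficientDomᶜ G support
    support-efficient ¬T₁ = outside , λ g in₁ → deg-independent G support-independent in₁
      where
      nbrTerm-exact : ∀ g g' → nbrTerm g g' ≡ 2 * indicator (adj G g g' ∧ support g')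
      nbrTerm-exact g g' with adj G g g'
      ... | true  = positive-exact (σ g') (fibre-two ¬T₁)
      ... | false = refl
      outside : ∀ g → support g ≡ false → deg G support g ≡ 1
      outside g out =
        let (lower , upper) = subst OneOrTwo nbrSum≡2deg (empty-fibre-nbrSum (positive-false out)) in
        ≤-antisym (*-cancelˡ-≤ 2 upper) (half-pos _ lower)
        where
        nbrSum≡2deg : nbrSum g ≡ 2 * deg G support g
        nbrSum≡2deg = trans (sum-cong-≗ (nbrTerm-exact g)) (sym (*-distribˡ-sum 2 (λ g' → indicator (adj G g g' ∧ support g'))))

    efficient-support : ¬ HasIndep12OfSize H 1 → HasEfficientDom G
    efficient-support ¬T₁ = tabulate support , Equivalence.from (efficientDom-tabulate G support) (support-efficient ¬T₁)

if-if-indicator : ∀ a d t → (if a then (if d then t else 0) else 0) ≡ t * indicator (a ∧ d)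
if-if-indicator true  true  t = sym (*-identityʳ t)
if-if-indicator true  false t = sym (*-zeroʳ t)
if-if-indicator false d     t = sym (*-zeroʳ t)

module Blowup (G H : Graph) (D : Fin (n G) → Bool) (T : Fin (n H) → Bool) where

  product : Fin (n G * n H) → Bool
  product z = D (proj₁ (remQuot {n G} (n H) z)) ∧ T (proj₂ (remQuot {n G} (n H) z))

  open Fibres G H product

  fibre-product : ∀ g h → fibre g h ≡ D g ∧ T h
  fibre-product g h = cong (λ gh → D (proj₁ gh) ∧ T (proj₂ gh)) (remQuot-combine {n G} {n H} g h)

  fibre-in : ∀ {g b} → D g ≡ b → ∀ h → fibre g h ≡ b ∧ T h
  fibre-in {g} Dg h = trans (fibre-product g h) (cong (_∧ T h) Dg)

  σ-product : ∀ {g} b → D g ≡ b → σ g ≡ (if b then count T else 0)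
  σ-product true  Dg = count-cong (fibre-in Dg)
  σ-product false Dg = trans (count-cong (fibre-in Dg)) (count-none {n H} (λ _ → false) (λ _ → refl))

  deg-fibre-product : ∀ {g} b h → D g ≡ b → deg H (fibre g) h ≡ (if b then deg H T h else 0)
  deg-fibre-product true  h Dg = count-cong λ h' → cong (adj H h h' ∧_) (fibre-in Dg h')
  deg-fibre-product false h Dg = trans (count-cong λ h' → cong (adj H h h' ∧_) (fibre-in Dg h'))
                                       (count-none (λ h' → adj H h h' ∧ false) (λ h' → ∧-zeroʳ (adj H h h')))

  nbrSum-product : ∀ g → nbrSum g ≡ count T * deg G D g
  nbrSum-product g = begin
    nbrSum g                                                  ≡⟨ sum-cong-≗ term ⟩
    ∑[ g' < n G ] (count T * indicator (adj G g g' ∧ D g'))   ≡⟨ *-distribˡ-sum (count T) (λ g' → indicator (adj G g g' ∧ D g')) ⟨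
    count T * deg G D g                                       ∎
    where
    open ≡-Reasoning
    term : ∀ g' → nbrTerm g g' ≡ count T * indicator (adj G g g' ∧ D g')
    term g' = trans (cong (λ s → if adj G g g' then s else 0) (σ-product (D g') refl))
                    (if-if-indicator (adj G g g') (D g') (count T))

  product-indep12 : (∀ x → adj G x x ≡ false) → Independentᶜ G D → IsIndep12ᶜ H T →
                    (∀ g → D g ≡ false → OneOrTwo (count T * deg G D g)) →
                    IsIndep12ᶜ (G ∘ₗ H) product
  product-indep12 irrefl D-indep (T-indep , T-bounded) D-outside =
    every-pair (λ g h → every-pair (λ g' h' → pairs-nonadjacent g h g' h')) ,
    every-pair outside
    where
    pairs-nonadjacent : ∀ g h g' h' → fibre g h ≡ true → fibre g' h' ≡ true →
                        lexAdj G H (combine g h) (combine g' h') ≡ false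
    pairs-nonadjacent g h g' h' in₁ in₂ = begin
      lexAdj G H (combine g h) (combine g' h')   ≡⟨ lexAdj-combine G H g h g' h' ⟩
      adj G g g' ∨ (⌊ g ≟ g' ⌋ ∧ adj H h h')     ≡⟨ cong₂ (λ a b → a ∨ (⌊ g ≟ g' ⌋ ∧ b))
                                                         (D-indep g g' (∧-conicalˡ _ _ DT₁) (∧-conicalˡ _ _ DT₂))
                                                         (T-indep h h' (∧-conicalʳ _ _ DT₁) (∧-conicalʳ _ _ DT₂)) ⟩
      ⌊ g ≟ g' ⌋ ∧ false                         ≡⟨ ∧-zeroʳ _ ⟩
      false                                      ∎
      where
      open ≡-Reasoning
      DT₁ : D g ∧ T h ≡ true
      DT₁ = trans (sym (fibre-product g h)) in₁
      DT₂ : D g' ∧ T h' ≡ true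
      DT₂ = trans (sym (fibre-product g' h')) in₂
    outside : ∀ g h → fibre g h ≡ false → OneOrTwo (deg (G ∘ₗ H) product (combine g h))
    outside g h out = subst OneOrTwo (sym (degree-formula irrefl g h)) (by-membership (D g) refl)
      where
      by-membership : ∀ b → D g ≡ b → OneOrTwo (nbrSum g + deg H (fibre g) h)
      by-membership true Dg
        rewrite nbrSum-product g | deg-independent G D-indep Dg | *-zeroʳ (count T) | deg-fibre-product true h Dg
        = T-bounded h (trans (sym (fibre-in Dg h)) out)
      by-membership false Dg
        rewrite nbrSum-product g | deg-fibre-product false h Dg | +-identityʳ (count T * deg G D g)
        = D-outside g Dg

product-set : ∀ G H → IsSimple G → (D : Fin (n G) → Bool) (T : Subset (n H)) →
              Independentᶜ G D → IsIndep12 H T →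
              (∀ g → D g ≡ false → OneOrTwo (∣ T ∣ * deg G D g)) → HasIndep12 (G ∘ₗ H)
product-set G H sG D T D-indep T-indep12 D-outside =
  tabulate product ,
  Equivalence.from (indep12-tabulate (G ∘ₗ H) product)
    (product-indep12 (IsSimple.irrefl sG) D-indep (indep12-lookup H T T-indep12)
      λ g out → subst (λ t → OneOrTwo (t * deg G D g)) (∣∣-lookup T) (D-outside g out))
  where open Blowup G H D (lookup T)

Conditions : Graph → Graph → Set
Conditions G H = (IsK1 G × HasIndep12 H)
               ⊎ (HasEfficientDom G × ∃[ k ] (GammaI12Is H k × k ≤ 2))
               ⊎ (HasIndep12 G × GammaI12Is H 1)

fin-one-unique : ∀ {m} → m ≡ 1 → (i j : Fin m) → i ≡ j
fin-one-unique refl zero zero = refl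

-- The whole vertex set of K₁ is independent: its only vertex has no loop.
K1-independent : ∀ G → IsSimple G → IsK1 G → Independentᶜ G (λ _ → true)
K1-independent G sG K1 g g' _ _ =
  subst (λ x → adj G x g' ≡ false) (sym (fin-one-unique K1 g g')) (IsSimple.irrefl sG g')

lex-indep12⇒conditions : ∀ G H → IsSimple G → IsSimple H → Connected G →
                         HasIndep12 (G ∘ₗ H) → Conditions G H
lex-indep12⇒conditions G H sG sH con (S , S-indep12) =
  outcome (m≤n⇒m<n∨m≡n (IsSimple.nonempty sG)) (singleton-indep12? H)
  where
  open Analysis G H sG sH (lookup S) (indep12-lookup (G ∘ₗ H) S S-indep12)
  outcome : 1 < n G ⊎ 1 ≡ n G → Dec (HasIndep12OfSize H 1) → Conditions G H
  outcome (inj₂ 1≡n) _        = inj₁ (sym 1≡n , fibre-set)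
  outcome (inj₁ two) (yes T₁) = inj₂ (inj₂ (support-set , gamma-one H (IsSimple.nonempty sH) T₁))
    where open Connected two con
  outcome (inj₁ two) (no ¬T₁) =
    inj₂ (inj₁ (efficient-support ¬T₁ , 2 , gamma-two H (IsSimple.nonempty sH) ¬T₁ (fibre-pair ¬T₁) , ≤-refl))
    where open Connected two con

-- Backward direction: D × T with D = V(K₁), an efficient dominating set,
-- or an independent [1,2]-set of G respectively.
conditions⇒lex-indep12 : ∀ G H → IsSimple G → IsSimple H → Conditions G H → HasIndep12 (G ∘ₗ H)
conditions⇒lex-indep12 G H sG sH (inj₁ (K1 , T , T-indep12)) =
  product-set G H sG (λ _ → true) T (K1-independent G sG K1) T-indep12 λ _ ()
conditions⇒lex-indep12 G H sG sH (inj₂ (inj₁ ((D , D-efficient) , k , ((T , T-indep12 , ∣T∣≡k) , _) , k≤2))) =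
  product-set G H sG (lookup D) T (efficient⇒independent G D′) T-indep12 λ g out →
    subst (λ d → OneOrTwo (∣ T ∣ * d)) (sym (proj₁ D′ g out)) (subst OneOrTwo (sym (*-identityʳ ∣ T ∣)) T-size)
  where
  D′ : IsEfficientDomᶜ G (lookup D)
  D′ = efficientDom-lookup G D D-efficient
  T-size : OneOrTwo ∣ T ∣
  T-size = indep12-size-pos H (IsSimple.nonempty sH) T-indep12 , subst (_≤ 2) (sym ∣T∣≡k) k≤2
conditions⇒lex-indep12 G H sG sH (inj₂ (inj₂ ((D , D-indep12) , (T , T-indep12 , ∣T∣≡1) , _))) =
  product-set G H sG (lookup D) T (proj₁ D′) T-indep12 λ g out →
    subst (λ t → OneOrTwo (t * deg G (lookup D) g)) (sym ∣T∣≡1)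
      (subst OneOrTwo (sym (*-identityˡ _)) (proj₂ D′ g out))
  where
  D′ : IsIndep12ᶜ G (lookup D)
  D′ = indep12-lookup G D D-indep12

theorem4p13 : (G H : Graph) → IsSimple G → IsSimple H → Connected G →
    HasIndep12 (G ∘ₗ H) ⇔
      ((IsK1 G × HasIndep12 H)
       ⊎ (HasEfficientDom G × ∃[ k ] (GammaI12Is H k × k ≤ 2))
       ⊎ (HasIndep12 G × GammaI12Is H 1))
theorem4p13 G H sG sH con =
  mk⇔ (lex-indep12⇒conditions G H sG sH con) (conditions⇒lex-indep12 G H sG sH)
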